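{- For every $k,q\in\mathbb{Z}_{>0}$, $$\chi^{\mathrm{quasi}}_{\widetilde Z_k}(q)=\frac{(q-1)(q-2)^k-(-2)^k(2q-1)}{q}+(-1)^k\sum_{j=0}^{k}\binom{k}{j}\gcd(j-1,q),$$ $$\chi^{\mathrm{quasi}}_{\widetilde N_k}(q)=\frac{(q-1)^k+(-1)^k(q-1)}{q}+\chi^{\mathrm{quasi}}_{\widetilde Z_k}(q),$$ where $\gcd(-1,q)=1$ and $\gcd(0,q)=q$.
   Context: $\mathbb{Z}_q:=\mathbb{Z}/q\mathbb{Z}$. Let $I_k$ be the $k\times k$ identity matrix, $J_k$ the $k\times k$ all-ones matrix, $1_k$ the all-ones column vector. $\widetilde N_k:=(I_k\mid J_k-I_k)\in\mathrm{Mat}_{k\times2k}(\mathbb{Z})$, $\widetilde Z_k:=(I_k\mid J_k-I_k\mid 1_k)\in\mathrm{Mat}_{k\times(2k+1)}(\mathbb{Z})$. For an integer matrix $G$ with $k$ rows and columns $g^1,\dots,g^n$, let $H_j(q):=\{u\in\mathbb{Z}_q^k\mid \sum_l u_lg^j_l=0\}$ and $\chi^{\mathrm{quasi}}_G(q):=\big|\mathbb{Z}_q^k\setminus\bigcup_{j=1}^nH_j(q)\big|$ (the number of $u\in\mathbb{Z}_q^k$ such that every entry of $uG$ is nonzero). -}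

module Defs where

open import Data.Nat as ℕ using (ℕ; zero; suc; NonZero)
open import Data.Nat.Combinatorics using (_C_)
open import Data.Integer as ℤ using (ℤ; +_; _%ℕ_)
open import Data.Integer.GCD using (gcd)
open import Data.Fin using (Fin; toℕ; splitAt)
import Data.Fin as Fin
open import Data.Fin.Properties using (_≟_)
open import Data.Vec using (Vec; []; _∷_; lookup)
open import Data.List using (List; [_]; concatMap; map; filter; length; sum; allFin; upTo)
open import Data.List.Relation.Unary.All using (All; all?)
open import Data.Sum using (inj₁; inj₂)
open import Relation.Binary.PropositionalEquality using (_≡_)
open import Relation.Nullary using (¬_; Dec; yes; no)
open import Relation.Nullary.Decidable using (¬?)
open import Data.Nat.Properties using () renaming (_≟_ to _≟ℕ_)

-- An integer matrix with k rows and n columns: entry (l , j) = g^j_l.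
IntMat : ℕ → ℕ → Set
IntMat k n = Fin k → Fin n → ℤ

-- All elements u ∈ ℤ_q^k, with ℤ_q represented by Fin q (residues 0 … q-1).
allVecs : (q k : ℕ) → List (Vec (Fin q) k)
allVecs q zero    = [ [] ]
allVecs q (suc k) = concatMap (λ i → map (i ∷_) (allVecs q k)) (allFin q)

-- Σ_l u_l g^j_l, computed in ℤ (lifting residues to 0 … q-1).
dotCol : ∀ {k n q} → Vec (Fin q) k → IntMat k n → Fin n → ℤ
dotCol {zero}  []      G j = + 0
dotCol {suc k} (x ∷ u) G j = (+ toℕ x) ℤ.* G Fin.zero j ℤ.+ dotCol u (λ l → G (Fin.suc l)) j

-- u lies on no hyperplane H_j(q): every entry of uG is nonzero in ℤ_q.
OffAll : ∀ {k n} (G : IntMat k n) (q : ℕ) .{{_ : NonZero q}} → Vec (Fin q) k → Set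
OffAll {n = n} G q u = All (λ j → ¬ ((dotCol u G j %ℕ q) ≡ 0)) (allFin n)

offAll? : ∀ {k n} (G : IntMat k n) (q : ℕ) .{{_ : NonZero q}} → (u : Vec (Fin q) k) → Dec (OffAll G q u)
offAll? {n = n} G q u = all? (λ j → ¬? ((dotCol u G j %ℕ q) ≟ℕ 0)) (allFin n)

χquasi : ∀ {k n} (G : IntMat k n) (q : ℕ) .{{_ : NonZero q}} → ℕ
χquasi {k} G q = length (filter (offAll? G q) (allVecs q k))

δ : ∀ {k} → Fin k → Fin k → ℤ
δ l i with l ≟ i
... | yes _ = + 1
... | no  _ = + 0

Ñ : (k : ℕ) → IntMat k (k ℕ.+ k)
Ñ k l j with splitAt k j
... | inj₁ i = δ l i
... | inj₂ i = + 1 ℤ.- δ l i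

Z̃ : (k : ℕ) → IntMat k ((k ℕ.+ k) ℕ.+ 1)
Z̃ k l j with splitAt (k ℕ.+ k) j
... | inj₁ i = Ñ k l i
... | inj₂ _ = + 1

-- Σ_{j=0}^{k} binom(k,j) · gcd(j-1, q), with gcd on ℤ (so gcd(-1,q)=1, gcd(0,q)=q).
binomGcdSum : ℕ → ℕ → ℤ
binomGcdSum k q = sum' (map (λ j → (+ (k C j)) ℤ.* gcd (+ j ℤ.- + 1) (+ q)) (upTo (suc k)))
  where
  sum' : List ℤ → ℤ
  sum' = Data.List.foldr ℤ._+_ (+ 0)

{-# OPTIONS --safe #-}
module Submission where

-- For u ∈ ℤ_q^k with coordinate sum S, the entries of uÑ_k are the u_i and the S − u_i, and uZ̃_k
-- has the extra entry S.  Hence χ_Ñ counts the u with every u_i ∉ {0, S}, and χ_Z̃ those which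
-- moreover have S ≢ 0.  Sorting by the value s of S, both reduce to
--   N_k(s, t) = #{u ∈ ℤ_q^k | every u_i ∉ {0, s}, Σ u_i ≡ t}   (count k s t)   at t = s.
-- Splitting off the first coordinate gives N_{k+1}(s, t) = Σ_{x ∉ {0, s}} N_k(s, t − x), and an
-- induction on k with this recursion yields
--   q N_k(s, t) = (q − 2)^k − (−2)^k + q (−1)^k Σ_j C(k, j) [t ≡ j s]     for s ≢ 0,
--   q N_k(0, t) = (q − 1)^k − (−1)^k + q (−1)^k [t ≡ 0].
-- Summing the first formula over s ≢ 0 at t = s brings in #{s ≢ 0 | s ≡ j s} = gcd(j − 1, q) − 1,
-- which is where the gcd sum comes from.

open import Level using (Level)
open import Function using (_∘_; _⇔_; mk⇔; Equivalence)
import Function.Properties.Equivalence as ⇔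
open import Data.Bool using (if_then_else_)
open import Data.Product as Product using (_×_; _,_; proj₁; proj₂)
open import Data.Product.Function.NonDependent.Propositional using (_×-⇔_)
open import Data.Sum using (_⊎_; inj₁; inj₂; [_,_]; [_,_]′)
open import Data.Nat as ℕ using (ℕ; zero; suc; NonZero; _≤_; _<_; s≤s)
import Data.Nat.Properties as ℕP
import Data.Nat.Divisibility as ℕ∣
import Data.Nat.DivMod as ℕDM
import Data.Nat.GCD as GCD
import Data.Nat.Coprimality as Coprime
open import Data.Nat.Combinatorics using (_C_; nCk+nC[k+1]≡[n+1]C[k+1]; k>n⇒nCk≡0)
open import Data.Integer as ℤ using (ℤ; +_; 0ℤ; 1ℤ; _+_; _*_; _-_; -_; _^_; _%ℕ_; _/ℕ_)
import Data.Integer.Properties as ℤP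
open import Data.Integer.DivMod using (a≡a%ℕn+[a/ℕn]*n; n%ℕd<d)
open import Data.Integer.Divisibility.Signed as ℤ∣ using (divides; _∣?_)
open import Data.Integer.GCD using (gcd)
open import Data.Integer.Tactic.RingSolver using (solve-∀)
open import Data.Rational as ℚ using (_/_; fromℚᵘ)
import Data.Rational.Properties as ℚP
open import Data.Rational.Unnormalised as ℚᵘ using (mkℚᵘ; *≡*)
import Data.Rational.Unnormalised.Properties as ℚᵘP
open import Data.Fin as Fin using (Fin; toℕ; splitAt; join)
import Data.Fin.Properties as FinP
open import Data.List as List using (List; []; _∷_; _++_; map; concatMap; filter; length; tabulate; applyUpTo)
import Data.List.Relation.Unary.All.Properties as ListAllP
open import Data.Vec using (Vec; []; _∷_; lookup)
import Data.Vec.Relation.Unary.All as VecAll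
import Data.Vec.Relation.Unary.All.Properties as VecAllP
open import Algebra.Properties.Semiring.Sum ℤP.+-*-semiring
  using (sum; sum-cong-≗; ∑-distrib-+; ∑-comm; *-distribˡ-sum)
open import Relation.Binary using (_Preserves_⟶_)
open import Relation.Binary.PropositionalEquality
open import Relation.Nullary using (¬_; Dec; yes; no; does; contradiction)
open import Relation.Nullary.Decidable using (_×-dec_; ¬?; map′)
open import Relation.Unary using (Decidable)

open import Defs using (binomGcdSum; allVecs; IntMat; dotCol; δ; Ñ; Z̃; OffAll; offAll?; χquasi)

private variable
  A B : Set
  ℓ ℓ′ : Level
  P : Set ℓ
  R : Set ℓ′

-- Defined via `does`, so that 𝟙 (suc m ≟ suc n) reduces to 𝟙 (m ≟ n).
𝟙 : Dec P → ℤ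
𝟙 d = if does d then 1ℤ else 0ℤ

𝟙-yes : (d : Dec P) → P → 𝟙 d ≡ 1ℤ
𝟙-yes (yes _) _  = refl
𝟙-yes (no ¬p) p = contradiction p ¬p

𝟙-no : (d : Dec P) → ¬ P → 𝟙 d ≡ 0ℤ
𝟙-no (yes p) ¬p = contradiction p ¬p
𝟙-no (no _)  _  = refl

𝟙-cong : (d : Dec P) (e : Dec R) → P ⇔ R → 𝟙 d ≡ 𝟙 e
𝟙-cong (yes p) e P⇔R = sym (𝟙-yes e (Equivalence.to P⇔R p))
𝟙-cong (no ¬p) e P⇔R = sym (𝟙-no e (¬p ∘ Equivalence.from P⇔R))

𝟙-× : (d : Dec P) (e : Dec R) → 𝟙 (d ×-dec e) ≡ 𝟙 d * 𝟙 e
𝟙-× (yes _) (yes _) = refl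
𝟙-× (yes _) (no _)  = refl
𝟙-× (no _)  (yes _) = refl
𝟙-× (no _)  (no _)  = refl

𝟙-¬ : (d : Dec P) → 𝟙 (¬? d) ≡ 1ℤ - 𝟙 d
𝟙-¬ (yes _) = refl
𝟙-¬ (no _)  = refl

𝟙-split : (d : Dec P) (e : Dec R) → 𝟙 e ≡ 𝟙 (¬? d ×-dec e) + 𝟙 (d ×-dec e)
𝟙-split (yes _) (yes _) = refl
𝟙-split (yes _) (no _)  = refl
𝟙-split (no _)  (yes _) = refl
𝟙-split (no _)  (no _)  = refl

𝟙-neither : (d : Dec P) (e : Dec R) → ¬ (P × R) → 𝟙 (¬? d ×-dec ¬? e) ≡ 1ℤ - 𝟙 d - 𝟙 e
𝟙-neither (yes p) (yes r) ¬pr = contradiction (p , r) ¬pr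
𝟙-neither (yes _) (no _)  _   = refl
𝟙-neither (no _)  (yes _) _   = refl
𝟙-neither (no _)  (no _)  _   = refl

𝟙*-cong : (d : Dec P) {x y : ℤ} → (P → x ≡ y) → 𝟙 d * x ≡ 𝟙 d * y
𝟙*-cong (yes p) x≡y = cong (1ℤ *_) (x≡y p)
𝟙*-cong (no _) {x} {y} _ = trans (ℤP.*-zeroˡ x) (sym (ℤP.*-zeroˡ y))

∑< : ℕ → (ℕ → ℤ) → ℤ
∑< n f = sum {n} (f ∘ toℕ)

∑<-cong : ∀ n {f g : ℕ → ℤ} → (∀ i → i < n → f i ≡ g i) → ∑< n f ≡ ∑< n g
∑<-cong n f≡g = sum-cong-≗ {n} (λ i → f≡g (toℕ i) (FinP.toℕ<n i))

∑<-+ : ∀ n (f g : ℕ → ℤ) → ∑< n (λ i → f i + g i) ≡ ∑< n f + ∑< n g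
∑<-+ n f g = ∑-distrib-+ {n} (f ∘ toℕ) (g ∘ toℕ)

∑<-*ˡ : ∀ n (c : ℤ) (f : ℕ → ℤ) → ∑< n (λ i → c * f i) ≡ c * ∑< n f
∑<-*ˡ n c f = sym (*-distribˡ-sum {n} c (f ∘ toℕ))

∑<-- : ∀ n (f g : ℕ → ℤ) → ∑< n (λ i → f i - g i) ≡ ∑< n f - ∑< n g
∑<-- n f g = begin
  ∑< n (λ i → f i - g i)           ≡⟨ ∑<-cong n (λ i _ → cong (_+_ (f i)) (sym (ℤP.-1*i≡-i (g i)))) ⟩
  ∑< n (λ i → f i + ℤ.-1ℤ * g i)   ≡⟨ ∑<-+ n f (λ i → ℤ.-1ℤ * g i) ⟩
  ∑< n f + ∑< n (λ i → ℤ.-1ℤ * g i) ≡⟨ cong (_+_ (∑< n f)) (trans (∑<-*ˡ n ℤ.-1ℤ g) (ℤP.-1*i≡-i _)) ⟩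
  ∑< n f - ∑< n g                  ∎
  where open ≡-Reasoning

∑<-comm : ∀ m n (f : ℕ → ℕ → ℤ) → ∑< m (λ i → ∑< n (f i)) ≡ ∑< n (λ j → ∑< m (λ i → f i j))
∑<-comm m n f = ∑-comm {m} {n} (λ i j → f (toℕ i) (toℕ j))

∑<-const : ∀ n c → ∑< n (λ _ → c) ≡ + n * c
∑<-const zero    c = sym (ℤP.*-zeroˡ c)
∑<-const (suc n) c = trans (cong (_+_ c) (∑<-const n c)) (distrib c (+ n))
  where
  distrib : ∀ c m → c + m * c ≡ (1ℤ + m) * c
  distrib = solve-∀

∑<-zero : ∀ n {f} → (∀ i → i < n → f i ≡ 0ℤ) → ∑< n f ≡ 0ℤ
∑<-zero n f≡0 = trans (∑<-cong n f≡0) (trans (∑<-const n 0ℤ) (ℤP.*-zeroʳ (+ n)))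

∑<-snoc : ∀ n f → ∑< (suc n) f ≡ ∑< n f + f n
∑<-snoc zero    f = trans (ℤP.+-identityʳ (f 0)) (sym (ℤP.+-identityˡ (f 0)))
∑<-snoc (suc n) f = trans (cong (_+_ (f 0)) (∑<-snoc n (f ∘ suc))) (sym (ℤP.+-assoc (f 0) _ _))

∑<-++ : ∀ m n f → ∑< (m ℕ.+ n) f ≡ ∑< m f + ∑< n (λ i → f (m ℕ.+ i))
∑<-++ zero    n f = sym (ℤP.+-identityˡ _)
∑<-++ (suc m) n f = trans (cong (_+_ (f 0)) (∑<-++ m n (f ∘ suc))) (sym (ℤP.+-assoc (f 0) _ _))

∑<-δ : ∀ n {r} (h : ℕ → ℤ) → r < n → ∑< n (λ i → 𝟙 (i ℕ.≟ r) * h i) ≡ h r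
∑<-δ (suc n) {zero} h _ = trans (cong₂ _+_ (ℤP.*-identityˡ (h 0)) (∑<-zero n (λ i _ → ℤP.*-zeroˡ (h (suc i)))))
                               (ℤP.+-identityʳ (h 0))
∑<-δ (suc n) {suc r} h (s≤s r<n) =
  trans (cong₂ _+_ (ℤP.*-zeroˡ (h 0)) (∑<-δ n (h ∘ suc) r<n)) (ℤP.+-identityˡ (h (suc r)))

∑-pascal : ∀ k (f : ℕ → ℤ) →
  ∑< (2 ℕ.+ k) (λ j → + (suc k C j) * f j)
    ≡ ∑< (suc k) (λ j → + (k C j) * f j) + ∑< (suc k) (λ j → + (k C j) * f (suc j))
∑-pascal k f = begin
  1ℤ * f 0 + ∑< (suc k) (λ j → + (suc k C suc j) * f (suc j))
    ≡⟨ cong (_+_ (1ℤ * f 0)) (trans (∑<-cong (suc k) pascal) (∑<-+ (suc k) low high)) ⟩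
  1ℤ * f 0 + (∑< (suc k) low + ∑< (suc k) high)
    ≡⟨ cong (λ x → 1ℤ * f 0 + (∑< (suc k) low + x)) (∑<-snoc k high) ⟩
  1ℤ * f 0 + (∑< (suc k) low + (∑< k high + high k))
    ≡⟨ cong (λ x → 1ℤ * f 0 + (∑< (suc k) low + (∑< k high + x))) top ⟩
  1ℤ * f 0 + (∑< (suc k) low + (∑< k high + 0ℤ))
    ≡⟨ reorder (1ℤ * f 0) (∑< (suc k) low) (∑< k high) ⟩
  (1ℤ * f 0 + ∑< k high) + ∑< (suc k) low
    ∎
  where
  open ≡-Reasoning
  low high : ℕ → ℤ
  low  j = + (k C j) * f (suc j)
  high j = + (k C suc j) * f (suc j)
  pascal : ∀ j → j < suc k → + (suc k C suc j) * f (suc j) ≡ low j + high j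
  pascal j _ = begin
    + (suc k C suc j) * f (suc j)                 ≡⟨ cong (λ c → + c * f (suc j)) (sym (nCk+nC[k+1]≡[n+1]C[k+1] k j)) ⟩
    + (k C j ℕ.+ k C suc j) * f (suc j)           ≡⟨ cong (_* f (suc j)) (ℤP.pos-+ (k C j) (k C suc j)) ⟩
    (+ (k C j) + + (k C suc j)) * f (suc j)       ≡⟨ ℤP.*-distribʳ-+ (f (suc j)) (+ (k C j)) (+ (k C suc j)) ⟩
    low j + high j                                ∎
  top : high k ≡ 0ℤ
  top = trans (cong (λ c → + c * f (suc k)) (k>n⇒nCk≡0 (ℕP.n<1+n k))) (ℤP.*-zeroˡ (f (suc k)))
  reorder : ∀ a x y → a + (x + (y + 0ℤ)) ≡ (a + y) + x
  reorder = solve-∀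

∑-binomial : ∀ k → ∑< (suc k) (λ j → + (k C j) * 1ℤ) ≡ (+ 2) ^ k
∑-binomial zero    = refl
∑-binomial (suc k) = begin
  ∑< (2 ℕ.+ k) (λ j → + (suc k C j) * 1ℤ)  ≡⟨ ∑-pascal k (λ _ → 1ℤ) ⟩
  S + S                                    ≡⟨ cong₂ _+_ (∑-binomial k) (∑-binomial k) ⟩
  (+ 2) ^ k + (+ 2) ^ k                    ≡⟨ double ((+ 2) ^ k) ⟩
  (+ 2) ^ suc k                            ∎
  where
  open ≡-Reasoning
  S = ∑< (suc k) (λ j → + (k C j) * 1ℤ)
  double : ∀ x → x + x ≡ + 2 * x
  double = solve-∀

^-neg : ∀ a k → (- a) ^ k ≡ (- 1ℤ) ^ k * a ^ k
^-neg a zero    = refl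
^-neg a (suc k) = trans (cong (- a *_) (^-neg a k)) (regroup a ((- 1ℤ) ^ k) (a ^ k))
  where
  regroup : ∀ a m p → - a * (m * p) ≡ - 1ℤ * m * (a * p)
  regroup = solve-∀

∑ᴸ : List A → (A → ℤ) → ℤ
∑ᴸ []       f = 0ℤ
∑ᴸ (x ∷ xs) f = f x + ∑ᴸ xs f

∑ᴸ-++ : (xs ys : List A) (f : A → ℤ) → ∑ᴸ (xs ++ ys) f ≡ ∑ᴸ xs f + ∑ᴸ ys f
∑ᴸ-++ []       ys f = sym (ℤP.+-identityˡ _)
∑ᴸ-++ (x ∷ xs) ys f = trans (cong (_+_ (f x)) (∑ᴸ-++ xs ys f)) (sym (ℤP.+-assoc (f x) _ _))

∑ᴸ-map : (g : A → B) (xs : List A) (f : B → ℤ) → ∑ᴸ (map g xs) f ≡ ∑ᴸ xs (f ∘ g)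
∑ᴸ-map g []       f = refl
∑ᴸ-map g (x ∷ xs) f = cong (_+_ (f (g x))) (∑ᴸ-map g xs f)

∑ᴸ-concatMap : (g : A → List B) (xs : List A) (f : B → ℤ) →
               ∑ᴸ (concatMap g xs) f ≡ ∑ᴸ xs (λ x → ∑ᴸ (g x) f)
∑ᴸ-concatMap g []       f = refl
∑ᴸ-concatMap g (x ∷ xs) f =
  trans (∑ᴸ-++ (g x) (concatMap g xs) f) (cong (_+_ (∑ᴸ (g x) f)) (∑ᴸ-concatMap g xs f))

∑ᴸ-tabulate : ∀ n (g : Fin n → A) (f : A → ℤ) → ∑ᴸ (tabulate g) f ≡ sum (f ∘ g)
∑ᴸ-tabulate zero    g f = refl
∑ᴸ-tabulate (suc n) g f = cong (_+_ (f (g Fin.zero))) (∑ᴸ-tabulate n (g ∘ Fin.suc) f)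

length-filter : ∀ {p} {P : A → Set p} (P? : Decidable P) (xs : List A) →
                + length (filter P? xs) ≡ ∑ᴸ xs (𝟙 ∘ P?)
length-filter P? []       = refl
length-filter P? (x ∷ xs) with P? x
... | yes _ = cong (_+_ 1ℤ) (length-filter P? xs)
... | no  _ = trans (length-filter P? xs) (sym (ℤP.+-identityˡ _))

∑ⱽ : ∀ n k → (Vec (Fin n) k → ℤ) → ℤ
∑ⱽ n zero    f = f []
∑ⱽ n (suc k) f = sum (λ i → ∑ⱽ n k (λ u → f (i ∷ u)))

module _ (n : ℕ) where

  ∑ⱽ-cong : ∀ k {f g : Vec (Fin n) k → ℤ} → (∀ u → f u ≡ g u) → ∑ⱽ n k f ≡ ∑ⱽ n k g
  ∑ⱽ-cong zero    f≡g = f≡g []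
  ∑ⱽ-cong (suc k) f≡g = sum-cong-≗ {n} (λ i → ∑ⱽ-cong k (λ u → f≡g (i ∷ u)))

  ∑ⱽ-+ : ∀ k (f g : Vec (Fin n) k → ℤ) → ∑ⱽ n k (λ u → f u + g u) ≡ ∑ⱽ n k f + ∑ⱽ n k g
  ∑ⱽ-+ zero    f g = refl
  ∑ⱽ-+ (suc k) f g = trans (sum-cong-≗ {n} (λ i → ∑ⱽ-+ k (λ u → f (i ∷ u)) (λ u → g (i ∷ u))))
                           (∑-distrib-+ {n} _ _)

  ∑ⱽ-*ˡ : ∀ k c (f : Vec (Fin n) k → ℤ) → ∑ⱽ n k (λ u → c * f u) ≡ c * ∑ⱽ n k f
  ∑ⱽ-*ˡ zero    c f = refl
  ∑ⱽ-*ˡ (suc k) c f = trans (sum-cong-≗ {n} (λ i → ∑ⱽ-*ˡ k c (λ u → f (i ∷ u))))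
                            (sym (*-distribˡ-sum {n} c _))

  ∑ⱽ-∑< : ∀ k m (f : Vec (Fin n) k → ℕ → ℤ) →
          ∑ⱽ n k (λ u → ∑< m (f u)) ≡ ∑< m (λ j → ∑ⱽ n k (λ u → f u j))
  ∑ⱽ-∑< zero    m f = refl
  ∑ⱽ-∑< (suc k) m f = trans (sum-cong-≗ {n} (λ i → ∑ⱽ-∑< k m (λ u → f (i ∷ u))))
                            (∑-comm {n} {m} (λ i j → ∑ⱽ n k (λ u → f (i ∷ u) (toℕ j))))

  ∑ᴸ-allVecs : ∀ k (f : Vec (Fin n) k → ℤ) → ∑ᴸ (allVecs n k) f ≡ ∑ⱽ n k f
  ∑ᴸ-allVecs zero    f = ℤP.+-identityʳ (f [])
  ∑ᴸ-allVecs (suc k) f = begin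
    ∑ᴸ (concatMap (λ i → map (i ∷_) (allVecs n k)) (List.allFin n)) f
      ≡⟨ ∑ᴸ-concatMap (λ i → map (i ∷_) (allVecs n k)) (List.allFin n) f ⟩
    ∑ᴸ (List.allFin n) (λ i → ∑ᴸ (map (i ∷_) (allVecs n k)) f)
      ≡⟨ ∑ᴸ-tabulate n (λ i → i) _ ⟩
    sum (λ i → ∑ᴸ (map (i ∷_) (allVecs n k)) f)
      ≡⟨ sum-cong-≗ {n} (λ i → trans (∑ᴸ-map (i ∷_) (allVecs n k) f) (∑ᴸ-allVecs k (λ u → f (i ∷ u)))) ⟩
    ∑ⱽ n (suc k) f
      ∎
    where open ≡-Reasoning

  length-filter-allVecs : ∀ k {p} {P : Vec (Fin n) k → Set p} (P? : Decidable P) →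
                          + length (filter P? (allVecs n k)) ≡ ∑ⱽ n k (𝟙 ∘ P?)
  length-filter-allVecs k P? = trans (length-filter P? (allVecs n k)) (∑ᴸ-allVecs k (𝟙 ∘ P?))

∀-splitAt : ∀ m {n} {P : Fin m ⊎ Fin n → Set ℓ} → (∀ j → P (splitAt m j)) → ∀ x → P x
∀-splitAt m {n} {P} P∘splitAt x = subst P (FinP.splitAt-join m n x) (P∘splitAt (join m n x))

∀-blocks⇔ : ∀ m {n} {P : ℤ → Set} {c : Fin (m ℕ.+ n) → ℤ} {f : Fin m ⊎ Fin n → ℤ} →
            (∀ j → c j ≡ f (splitAt m j)) → (∀ j → P (c j)) ⇔ (∀ x → P (f x))
∀-blocks⇔ m {P = P} c≡f = mk⇔ (λ Pc → ∀-splitAt m (λ j → subst P (c≡f j) (Pc j)))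
                              (λ Pf j → subst P (sym (c≡f j)) (Pf (splitAt m j)))

∀-⊎⇔ : ∀ {n} {P : ℤ → Set} (c : Fin n → ℤ) (z : ℤ) →
       (∀ (x : Fin n ⊎ Fin 1) → P ([ c , (λ _ → z) ]′ x)) ⇔ ((∀ j → P (c j)) × P z)
∀-⊎⇔ c z = mk⇔ (λ Px → (Px ∘ inj₁) , Px (inj₂ Fin.zero)) (λ (Pc , Pz) → [_,_] Pc (λ _ → Pz))

δ≡𝟙 : ∀ {k} (l i : Fin k) → δ l i ≡ 𝟙 (l FinP.≟ i)
δ≡𝟙 l i with l FinP.≟ i
... | yes _ = refl
... | no  _ = refl

Ñ-column : ∀ k l j → Ñ k l j ≡ [ δ l , (λ i → 1ℤ - δ l i) ]′ (splitAt k j)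
Ñ-column k l j with splitAt k j
... | inj₁ _ = refl
... | inj₂ _ = refl

Z̃-column : ∀ k l j → Z̃ k l j ≡ [ Ñ k l , (λ _ → 1ℤ) ]′ (splitAt (k ℕ.+ k) j)
Z̃-column k l j with splitAt (k ℕ.+ k) j
... | inj₁ _ = refl
... | inj₂ _ = refl

∑<-multiples : ∀ m d .{{_ : NonZero d}} → ∑< (m ℕ.* d) (λ s → 𝟙 (d ℕ∣.∣? s)) ≡ + m
∑<-multiples zero    d = refl
∑<-multiples (suc m) d@(suc d-1) = begin
  ∑< (d ℕ.+ m ℕ.* d) (λ s → 𝟙 (d ℕ∣.∣? s))
    ≡⟨ ∑<-++ d (m ℕ.* d) (λ s → 𝟙 (d ℕ∣.∣? s)) ⟩
  𝟙 (d ℕ∣.∣? 0) + ∑< d-1 (λ s → 𝟙 (d ℕ∣.∣? suc s)) + ∑< (m ℕ.* d) (λ s → 𝟙 (d ℕ∣.∣? d ℕ.+ s))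
    ≡⟨ cong₂ (λ a b → a + b + ∑< (m ℕ.* d) (λ s → 𝟙 (d ℕ∣.∣? d ℕ.+ s)))
             (𝟙-yes (d ℕ∣.∣? 0) (d ℕ∣.∣0))
             (∑<-zero d-1 (λ s s<d-1 → 𝟙-no (d ℕ∣.∣? suc s) (ℕ∣.>⇒∤ (s≤s s<d-1)))) ⟩
  1ℤ + 0ℤ + ∑< (m ℕ.* d) (λ s → 𝟙 (d ℕ∣.∣? d ℕ.+ s))
    ≡⟨ cong (_+_ 1ℤ) (∑<-cong (m ℕ.* d) (λ s _ → 𝟙-cong (d ℕ∣.∣? d ℕ.+ s) (d ℕ∣.∣? s)
                        (mk⇔ (λ d∣d+s → ℕ∣.∣m+n∣m⇒∣n d∣d+s ℕ∣.∣-refl) (ℕ∣.∣m∣n⇒∣m+n ℕ∣.∣-refl)))) ⟩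
  1ℤ + ∑< (m ℕ.* d) (λ s → 𝟙 (d ℕ∣.∣? s))
    ≡⟨ cong (_+_ 1ℤ) (∑<-multiples m d) ⟩
  + suc m
    ∎
  where open ≡-Reasoning

∑<-∣* : ∀ n q .{{_ : NonZero q}} → ∑< q (λ s → 𝟙 (q ℕ∣.∣? n ℕ.* s)) ≡ + GCD.gcd n q
∑<-∣* n q = begin
  ∑< q (λ s → 𝟙 (q ℕ∣.∣? n ℕ.* s))
    ≡⟨ ∑<-cong q (λ s _ → 𝟙-cong (q ℕ∣.∣? n ℕ.* s) (q′ ℕ∣.∣? s) (mk⇔ to from)) ⟩
  ∑< q (λ s → 𝟙 (q′ ℕ∣.∣? s))
    ≡⟨ cong (λ m → ∑< m (λ s → 𝟙 (q′ ℕ∣.∣? s))) (sym (ℕDM.m*[n/m]≡n g∣q)) ⟩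
  ∑< (g ℕ.* q′) (λ s → 𝟙 (q′ ℕ∣.∣? s))
    ≡⟨ ∑<-multiples g q′ ⟩
  + g
    ∎
  where
  open ≡-Reasoning
  g = GCD.gcd n q
  instance
    g≢0 : NonZero g
    g≢0 = ℕ.≢-nonZero (GCD.gcd[m,n]≢0 n q (inj₂ (ℕ.≢-nonZero⁻¹ q)))
  g∣q = GCD.gcd[m,n]∣n n q
  n′ = n ℕ./ g
  q′ = q ℕ./ g
  instance
    q′≢0 : NonZero q′
    q′≢0 = ℕ.>-nonZero (ℕDM.m≥n⇒m/n>0 (ℕ∣.∣⇒≤ g∣q))
  q≡q′g : q ≡ q′ ℕ.* g
  q≡q′g = sym (ℕDM.m/n*n≡m g∣q)
  ns≡n′sg : ∀ s → n ℕ.* s ≡ n′ ℕ.* s ℕ.* g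
  ns≡n′sg s = begin
    n ℕ.* s              ≡⟨ cong (ℕ._* s) (sym (ℕDM.m/n*n≡m (GCD.gcd[m,n]∣m n q))) ⟩
    n′ ℕ.* g ℕ.* s       ≡⟨ ℕP.*-assoc n′ g s ⟩
    n′ ℕ.* (g ℕ.* s)     ≡⟨ cong (n′ ℕ.*_) (ℕP.*-comm g s) ⟩
    n′ ℕ.* (s ℕ.* g)     ≡⟨ ℕP.*-assoc n′ s g ⟨
    n′ ℕ.* s ℕ.* g       ∎
  to : ∀ {s} → q ℕ∣.∣ n ℕ.* s → q′ ℕ∣.∣ s
  to {s} q∣ns = Coprime.coprime-divisor (Coprime.sym (Coprime.coprime-/gcd n q))
                  (ℕ∣.*-cancelʳ-∣ g (subst₂ ℕ∣._∣_ q≡q′g (ns≡n′sg s) q∣ns))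
  from : ∀ {s} → q′ ℕ∣.∣ s → q ℕ∣.∣ n ℕ.* s
  from {s} q′∣s = subst₂ ℕ∣._∣_ (sym q≡q′g) (sym (ns≡n′sg s))
                    (ℕ∣.*-monoˡ-∣ g (ℕ∣.∣n⇒∣m*n n′ q′∣s))

∑<-∣*ℤ : ∀ a q .{{_ : NonZero q}} → ∑< q (λ s → 𝟙 (+ q ∣? a * + s)) ≡ gcd a (+ q)
∑<-∣*ℤ a q = trans (∑<-cong q (λ s _ → 𝟙-cong (+ q ∣? a * + s) (q ℕ∣.∣? ℤ.∣ a ∣ ℕ.* s) (mk⇔
               (λ q∣as → subst (q ℕ∣.∣_) (ℤP.∣i*j∣≡∣i∣*∣j∣ a (+ s)) (ℤ∣.∣⇒∣ᵤ q∣as))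
               (λ q∣∣a∣s → ℤ∣.∣ᵤ⇒∣ (subst (q ℕ∣.∣_) (sym (ℤP.∣i*j∣≡∣i∣*∣j∣ a (+ s))) q∣∣a∣s)))))
             (∑<-∣* ℤ.∣ a ∣ q)

foldr-+-applyUpTo : ∀ n (g : ℕ → ℕ) (f : ℕ → ℤ) → List.foldr _+_ 0ℤ (map f (applyUpTo g n)) ≡ ∑< n (f ∘ g)
foldr-+-applyUpTo zero    g f = refl
foldr-+-applyUpTo (suc n) g f = cong (_+_ (f (g 0))) (foldr-+-applyUpTo n (g ∘ suc) f)

binomGcdSum≡∑< : ∀ k q → binomGcdSum k q ≡ ∑< (suc k) (λ j → + (k C j) * gcd (+ j - 1ℤ) (+ q))
binomGcdSum≡∑< k q = foldr-+-applyUpTo (suc k) (λ j → j) (λ j → + (k C j) * gcd (+ j - 1ℤ) (+ q))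

fromℚᵘ-homo-+ : ∀ p r → fromℚᵘ (p ℚᵘ.+ r) ≡ fromℚᵘ p ℚ.+ fromℚᵘ r
fromℚᵘ-homo-+ p r = ℚP.toℚᵘ-injective (begin
  ℚ.toℚᵘ (fromℚᵘ (p ℚᵘ.+ r))                       ≈⟨ ℚP.toℚᵘ-fromℚᵘ (p ℚᵘ.+ r) ⟩
  p ℚᵘ.+ r                                         ≈⟨ ℚᵘP.+-cong (ℚP.toℚᵘ-fromℚᵘ p) (ℚP.toℚᵘ-fromℚᵘ r) ⟨
  ℚ.toℚᵘ (fromℚᵘ p) ℚᵘ.+ ℚ.toℚᵘ (fromℚᵘ r)         ≈⟨ ℚP.toℚᵘ-homo-+ (fromℚᵘ p) (fromℚᵘ r) ⟨
  ℚ.toℚᵘ (fromℚᵘ p ℚ.+ fromℚᵘ r)                   ∎)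
  where open ℚᵘP.≃-Reasoning

q*x≡n+q*b⇒x≡n/q+b : ∀ x n b q .{{_ : NonZero q}} → + q * x ≡ n + + q * b → x / 1 ≡ n / q ℚ.+ b / 1
q*x≡n+q*b⇒x≡n/q+b x n b q@(suc q-1) qx≡n+qb =
  trans (ℚP.fromℚᵘ-cong {mkℚᵘ x 0} {mkℚᵘ n q-1 ℚᵘ.+ mkℚᵘ b 0} (*≡* cross-multiplied))
        (fromℚᵘ-homo-+ (mkℚᵘ n q-1) (mkℚᵘ b 0))
  where
  open ≡-Reasoning
  rearrange : ∀ n b q → n + q * b ≡ (n * 1ℤ + b * q) * 1ℤ
  rearrange = solve-∀
  cross-multiplied : x * + (q ℕ.* 1) ≡ (n * 1ℤ + b * + q) * 1ℤ
  cross-multiplied = begin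
    x * + (q ℕ.* 1)            ≡⟨ cong (λ m → x * + m) (ℕP.*-identityʳ q) ⟩
    x * + q                    ≡⟨ ℤP.*-comm x (+ q) ⟩
    + q * x                    ≡⟨ qx≡n+qb ⟩
    n + + q * b                ≡⟨ rearrange n b (+ q) ⟩
    (n * 1ℤ + b * + q) * 1ℤ    ∎

module Modulo (q : ℕ) .{{_ : NonZero q}} where

  private
    Q : ℤ
    Q = + q

  infix 4 _∼_ _∼?_

  -- A record rather than a synonym, so that a ∼ b determines a and b in unification.
  record _∼_ (a b : ℤ) : Set where
    constructor mk∼
    field divides-diff : + q ℤ∣.∣ a - b

  open _∼_

  _∼?_ : (a b : ℤ) → Dec (a ∼ b)
  a ∼? b = map′ mk∼ divides-diff (+ q ∣? (a - b))

  ∣⇒∼ : ∀ {a b c} → a - b ≡ c → + q ℤ∣.∣ c → a ∼ b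
  ∣⇒∼ refl = mk∼

  ∼-by-diff : ∀ {a b c d} → a - b ≡ c - d → c ∼ d → a ∼ b
  ∼-by-diff a-b≡c-d c∼d = ∣⇒∼ a-b≡c-d (divides-diff c∼d)

  ∼-refl : ∀ {a} → a ∼ a
  ∼-refl {a} = mk∼ (divides 0ℤ (ℤP.+-inverseʳ a))

  ∼-reflexive : ∀ {a b} → a ≡ b → a ∼ b
  ∼-reflexive refl = ∼-refl

  ∼-sym : ∀ {a b} → a ∼ b → b ∼ a
  ∼-sym {a} {b} (mk∼ q∣a-b) = ∣⇒∼ (flip a b) (ℤ∣.∣m⇒∣-m q∣a-b)
    where
    flip : ∀ a b → b - a ≡ - (a - b)
    flip = solve-∀

  ∼-trans : ∀ {a b c} → a ∼ b → b ∼ c → a ∼ c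
  ∼-trans {a} {b} {c} (mk∼ q∣a-b) (mk∼ q∣b-c) = ∣⇒∼ (chain a b c) (ℤ∣.∣m∣n⇒∣m+n q∣a-b q∣b-c)
    where
    chain : ∀ a b c → a - c ≡ (a - b) + (b - c)
    chain = solve-∀

  ∼-+ : ∀ {a b c d} → a ∼ b → c ∼ d → a + c ∼ b + d
  ∼-+ {a} {b} {c} {d} (mk∼ q∣a-b) (mk∼ q∣c-d) = ∣⇒∼ (regroup a b c d) (ℤ∣.∣m∣n⇒∣m+n q∣a-b q∣c-d)
    where
    regroup : ∀ a b c d → (a + c) - (b + d) ≡ (a - b) + (c - d)
    regroup = solve-∀

  ∼-neg : ∀ {a b} → a ∼ b → - a ∼ - b
  ∼-neg {a} {b} (mk∼ q∣a-b) = ∣⇒∼ (negate a b) (ℤ∣.∣m⇒∣-m q∣a-b)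
    where
    negate : ∀ a b → - a - - b ≡ - (a - b)
    negate = solve-∀

  ∼-*ˡ : ∀ c {a b} → a ∼ b → c * a ∼ c * b
  ∼-*ˡ c {a} {b} (mk∼ q∣a-b) = ∣⇒∼ (distrib c a b) (ℤ∣.∣n⇒∣m*n c q∣a-b)
    where
    distrib : ∀ c a b → c * a - c * b ≡ c * (a - b)
    distrib = solve-∀

  ∼-%ℕ : ∀ a → a ∼ + (a %ℕ q)
  ∼-%ℕ a = mk∼ (divides (a /ℕ q) (begin
    a - + (a %ℕ q)                             ≡⟨ cong (_- + (a %ℕ q)) (a≡a%ℕn+[a/ℕn]*n a q) ⟩
    + (a %ℕ q) + a /ℕ q * + q - + (a %ℕ q)     ≡⟨ cancel (+ (a %ℕ q)) (a /ℕ q * + q) ⟩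
    a /ℕ q * + q                               ∎))
    where
    open ≡-Reasoning
    cancel : ∀ r x → r + x - r ≡ x
    cancel = solve-∀

  private
    small-multiple : ∀ {m} → q ℕ∣.∣ m → m < q → m ≡ 0
    small-multiple {zero}  _   _   = refl
    small-multiple {suc m} q∣m m<q = contradiction (ℕ∣.∣⇒≤ q∣m) (ℕP.<⇒≱ m<q)

    ordered-residue-injective : ∀ {i j} → i ℕ.≤ j → j < q → + i ∼ + j → i ≡ j
    ordered-residue-injective {i} {j} i≤j j<q (mk∼ q∣i-j) =
      ℕP.≤-antisym i≤j (ℕP.m∸n≡0⇒m≤n (small-multiple q∣j∸i (ℕP.≤-<-trans (ℕP.m∸n≤m j i) j<q)))
      where
      q∣j∸i : q ℕ∣.∣ j ℕ.∸ i
      q∣j∸i = subst (q ℕ∣.∣_) (trans (cong ℤ.∣_∣ (ℤP.[+m]-[+n]≡m⊖n i j)) (ℤP.∣⊖∣-≤ i≤j))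
                    (ℤ∣.∣⇒∣ᵤ q∣i-j)

  residue-injective : ∀ {i j} → i < q → j < q → + i ∼ + j → i ≡ j
  residue-injective {i} {j} i<q j<q i∼j with ℕP.≤-total i j
  ... | inj₁ i≤j = ordered-residue-injective i≤j j<q i∼j
  ... | inj₂ j≤i = sym (ordered-residue-injective j≤i i<q (∼-sym i∼j))

  %ℕ≡0⇒∼0 : ∀ a → a %ℕ q ≡ 0 → a ∼ 0ℤ
  %ℕ≡0⇒∼0 a a%q≡0 = ∼-trans (∼-%ℕ a) (∼-reflexive (cong +_ a%q≡0))

  ∼0⇒%ℕ≡0 : ∀ a → a ∼ 0ℤ → a %ℕ q ≡ 0
  ∼0⇒%ℕ≡0 a a∼0 = residue-injective (n%ℕd<d a q) (ℕ.>-nonZero⁻¹ q) (∼-trans (∼-sym (∼-%ℕ a)) a∼0)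

  ∑ᵣ : (ℤ → ℤ) → ℤ
  ∑ᵣ h = ∑< q (h ∘ +_)

  ∑ᵣ-δ : ∀ c {h : ℤ → ℤ} → h Preserves _∼_ ⟶ _≡_ → ∑ᵣ (λ x → 𝟙 (x ∼? c) * h x) ≡ h c
  ∑ᵣ-δ c {h} h-resp = begin
    ∑ᵣ (λ x → 𝟙 (x ∼? c) * h x)          ≡⟨ ∑<-cong q (λ i i<q → cong (_* h (+ i)) (same-indicator i i<q)) ⟩
    ∑< q (λ i → 𝟙 (i ℕ.≟ r) * h (+ i))   ≡⟨ ∑<-δ q (h ∘ +_) (n%ℕd<d c q) ⟩
    h (+ r)                              ≡⟨ h-resp (∼-sym (∼-%ℕ c)) ⟩
    h c                                  ∎
    where
    open ≡-Reasoning
    r = c %ℕ q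
    same-indicator : ∀ i → i < q → 𝟙 (+ i ∼? c) ≡ 𝟙 (i ℕ.≟ r)
    same-indicator i i<q = 𝟙-cong (+ i ∼? c) (i ℕ.≟ r) (mk⇔
      (λ i∼c → residue-injective i<q (n%ℕd<d c q) (∼-trans i∼c (∼-%ℕ c)))
      (λ { refl → ∼-sym (∼-%ℕ c) }))

  ∑ᵣ-𝟙 : ∀ c → ∑ᵣ (λ x → 𝟙 (x ∼? c)) ≡ 1ℤ
  ∑ᵣ-𝟙 c = trans
    (∑<-cong q {f = λ i → 𝟙 (+ i ∼? c)} {g = λ i → 𝟙 (+ i ∼? c) * 1ℤ} (λ i _ → sym (ℤP.*-identityʳ _)))
    (∑ᵣ-δ c {λ _ → 1ℤ} (λ _ → refl))

  ∑ᵣ-𝟙-sub : ∀ t c → ∑ᵣ (λ x → 𝟙 (t - x ∼? c)) ≡ 1ℤ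
  ∑ᵣ-𝟙-sub t c = trans
    (∑<-cong q {g = λ i → 𝟙 (+ i ∼? t - c)} (λ i _ → 𝟙-cong (t - + i ∼? c) (+ i ∼? t - c) (mk⇔
      (λ t-i∼c → ∼-by-diff (swap t c (+ i)) (∼-sym t-i∼c))
      (λ i∼t-c → ∼-sym (∼-by-diff (sym (swap t c (+ i))) i∼t-c)))))
    (∑ᵣ-𝟙 (t - c))
    where
    swap : ∀ t c x → x - (t - c) ≡ c - (t - x)
    swap = solve-∀

  ∑ᵣ-nonzero : ∀ {h : ℤ → ℤ} → h Preserves _∼_ ⟶ _≡_ →
               ∑ᵣ (λ x → 𝟙 (¬? (x ∼? 0ℤ)) * h x) ≡ ∑ᵣ h - h 0ℤ
  ∑ᵣ-nonzero {h} h-resp = begin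
    ∑ᵣ (λ x → 𝟙 (¬? (x ∼? 0ℤ)) * h x)
      ≡⟨ ∑<-cong q (λ i _ → trans (cong (_* h (+ i)) (𝟙-¬ (+ i ∼? 0ℤ))) (distrib (h (+ i)) (𝟙 (+ i ∼? 0ℤ)))) ⟩
    ∑< q (λ i → h (+ i) - 𝟙 (+ i ∼? 0ℤ) * h (+ i))
      ≡⟨ ∑<-- q (h ∘ +_) (λ i → 𝟙 (+ i ∼? 0ℤ) * h (+ i)) ⟩
    ∑ᵣ h - ∑ᵣ (λ x → 𝟙 (x ∼? 0ℤ) * h x)
      ≡⟨ cong (_-_ (∑ᵣ h)) (∑ᵣ-δ 0ℤ h-resp) ⟩
    ∑ᵣ h - h 0ℤ
      ∎
    where
    open ≡-Reasoning
    distrib : ∀ h a → (1ℤ - a) * h ≡ h - a * h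
    distrib = solve-∀

  Avoids : ℤ → ℤ → Set
  Avoids s x = ¬ x ∼ 0ℤ × ¬ x ∼ s

  avoids? : ∀ s x → Dec (Avoids s x)
  avoids? s x = ¬? (x ∼? 0ℤ) ×-dec ¬? (x ∼? s)

  ∑ᵣ-avoiding : ∀ {s} {h : ℤ → ℤ} → h Preserves _∼_ ⟶ _≡_ → ¬ s ∼ 0ℤ →
                ∑ᵣ (λ x → 𝟙 (avoids? s x) * h x) ≡ ∑ᵣ h - h 0ℤ - h s
  ∑ᵣ-avoiding {s} {h} h-resp s≁0 = begin
    ∑ᵣ (λ x → 𝟙 (avoids? s x) * h x)
      ≡⟨ ∑<-cong q (λ i _ → trans (cong (_* h (+ i)) (𝟙-neither (+ i ∼? 0ℤ) (+ i ∼? s) both))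
                                  (distrib (h (+ i)) (𝟙 (+ i ∼? 0ℤ)) (𝟙 (+ i ∼? s)))) ⟩
    ∑< q (λ i → h (+ i) - δ₀ i - δₛ i)
      ≡⟨ ∑<-- q (λ i → h (+ i) - δ₀ i) δₛ ⟩
    ∑< q (λ i → h (+ i) - δ₀ i) - ∑< q δₛ
      ≡⟨ cong₂ _-_ (∑<-- q (h ∘ +_) δ₀) (∑ᵣ-δ s h-resp) ⟩
    ∑ᵣ h - ∑< q δ₀ - h s
      ≡⟨ cong (λ z → ∑ᵣ h - z - h s) (∑ᵣ-δ 0ℤ h-resp) ⟩
    ∑ᵣ h - h 0ℤ - h s
      ∎
    where
    open ≡-Reasoning
    δ₀ δₛ : ℕ → ℤ
    δ₀ i = 𝟙 (+ i ∼? 0ℤ) * h (+ i)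
    δₛ i = 𝟙 (+ i ∼? s) * h (+ i)
    both : ∀ {x} → ¬ (x ∼ 0ℤ × x ∼ s)
    both (x∼0 , x∼s) = s≁0 (∼-trans (∼-sym x∼s) x∼0)
    distrib : ∀ h a b → (1ℤ - a - b) * h ≡ h - a * h - b * h
    distrib = solve-∀

  ∑ᵣ-avoiding₀ : ∀ {s} {h : ℤ → ℤ} → h Preserves _∼_ ⟶ _≡_ → s ∼ 0ℤ →
                 ∑ᵣ (λ x → 𝟙 (avoids? s x) * h x) ≡ ∑ᵣ h - h 0ℤ
  ∑ᵣ-avoiding₀ {s} {h} h-resp s∼0 = trans
    (∑<-cong q (λ i _ → cong (_* h (+ i)) (𝟙-cong (avoids? s (+ i)) (¬? (+ i ∼? 0ℤ))
                          (mk⇔ proj₁ (λ i≁0 → i≁0 , λ i∼s → i≁0 (∼-trans i∼s s∼0))))))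
    (∑ᵣ-nonzero h-resp)

  val : Fin q → ℤ
  val x = + toℕ x

  total : ∀ {k} → Vec (Fin q) k → ℤ
  total []      = 0ℤ
  total (x ∷ u) = val x + total u

  Avoiding : ∀ {k} → ℤ → Vec (Fin q) k → Set
  Avoiding s = VecAll.All (Avoids s ∘ val)

  avoiding? : ∀ {k} s (u : Vec (Fin q) k) → Dec (Avoiding s u)
  avoiding? s = VecAll.all? (avoids? s ∘ val)

  Avoiding-resp : ∀ {k s s′} {u : Vec (Fin q) k} → s ∼ s′ → Avoiding s u → Avoiding s′ u
  Avoiding-resp s∼s′ = VecAll.map (λ (x≁0 , x≁s) → x≁0 , λ x∼s′ → x≁s (∼-trans x∼s′ (∼-sym s∼s′)))

  count : ℕ → ℤ → ℤ → ℤ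
  count k s t = ∑ⱽ q k (λ u → 𝟙 (avoiding? s u ×-dec (total u ∼? t)))

  count-suc : ∀ k s t → count (suc k) s t ≡ ∑ᵣ (λ x → 𝟙 (avoids? s x) * count k s (t - x))
  count-suc k s t = sum-cong-≗ {q} λ i → trans (∑ⱽ-cong q k (λ u → first-coordinate i u))
                                               (∑ⱽ-*ˡ q k (𝟙 (avoids? s (val i))) _)
    where
    shift : ∀ x S t → S - (t - x) ≡ (x + S) - t
    shift = solve-∀
    first-coordinate : ∀ i (u : Vec (Fin q) k) →
      𝟙 (avoiding? s (i ∷ u) ×-dec (total (i ∷ u) ∼? t))
        ≡ 𝟙 (avoids? s (val i)) * 𝟙 (avoiding? s u ×-dec (total u ∼? t - val i))
    first-coordinate i u = trans
      (𝟙-cong (avoiding? s (i ∷ u) ×-dec (total (i ∷ u) ∼? t))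
              (avoids? s (val i) ×-dec (avoiding? s u ×-dec (total u ∼? t - val i))) (mk⇔
              (λ { (a VecAll.∷ as , Σ∼t) → a , as , ∼-by-diff (shift (val i) (total u) t) Σ∼t })
              (λ { (a , as , Σ∼t) → a VecAll.∷ as , ∼-by-diff (sym (shift (val i) (total u) t)) Σ∼t })))
      (𝟙-× (avoids? s (val i)) (avoiding? s u ×-dec (total u ∼? t - val i)))

  -- The number of words in {0, s}^k with letter sum ≡ t, grouped by the number j of letters s.
  binaryWords : ℕ → ℤ → ℤ → ℤ
  binaryWords k s t = ∑< (suc k) (λ j → + (k C j) * 𝟙 (t ∼? + j * s))

  binaryWords-respʳ : ∀ k s {t t′} → t ∼ t′ → binaryWords k s t ≡ binaryWords k s t′
  binaryWords-respʳ k s {t} {t′} t∼t′ = ∑<-cong (suc k) λ j _ → cong (_*_ (+ (k C j)))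
    (𝟙-cong (t ∼? + j * s) (t′ ∼? + j * s) (mk⇔ (∼-trans (∼-sym t∼t′)) (∼-trans t∼t′)))

  binaryWords-suc : ∀ k s t → binaryWords (suc k) s t ≡ binaryWords k s t + binaryWords k s (t - s)
  binaryWords-suc k s t = trans (∑-pascal k (λ j → 𝟙 (t ∼? + j * s)))
    (cong (_+_ (binaryWords k s t)) (∑<-cong (suc k) λ j _ → cong (_*_ (+ (k C j)))
      (𝟙-cong (t ∼? + suc j * s) (t - s ∼? + j * s)
              (mk⇔ (∼-by-diff (shift t s (+ j))) (∼-by-diff (sym (shift t s (+ j))))))))
    where
    shift : ∀ t s j → (t - s) - j * s ≡ t - (1ℤ + j) * s
    shift = solve-∀

  ∑ᵣ-binaryWords : ∀ k s t → ∑ᵣ (λ x → binaryWords k s (t - x)) ≡ (+ 2) ^ k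
  ∑ᵣ-binaryWords k s t = begin
    ∑ᵣ (λ x → binaryWords k s (t - x))
      ≡⟨ ∑<-comm q (suc k) (λ i j → + (k C j) * 𝟙 (t - + i ∼? + j * s)) ⟩
    ∑< (suc k) (λ j → ∑< q (λ i → + (k C j) * 𝟙 (t - + i ∼? + j * s)))
      ≡⟨ ∑<-cong (suc k) (λ j _ → trans (∑<-*ˡ q (+ (k C j)) (λ i → 𝟙 (t - + i ∼? + j * s)))
                                        (cong (_*_ (+ (k C j))) (∑ᵣ-𝟙-sub t (+ j * s)))) ⟩
    ∑< (suc k) (λ j → + (k C j) * 1ℤ)
      ≡⟨ ∑-binomial k ⟩
    (+ 2) ^ k
      ∎
    where open ≡-Reasoning

  scaled-count-suc : ∀ k s t →
    Q * count (suc k) s t ≡ ∑ᵣ (λ x → 𝟙 (avoids? s x) * (Q * count k s (t - x)))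
  scaled-count-suc k s t = begin
    Q * count (suc k) s t
      ≡⟨ cong (Q *_) (count-suc k s t) ⟩
    Q * ∑ᵣ (λ x → 𝟙 (avoids? s x) * count k s (t - x))
      ≡⟨ ∑<-*ˡ q Q (λ i → 𝟙 (avoids? s (+ i)) * count k s (t - + i)) ⟨
    ∑ᵣ (λ x → Q * (𝟙 (avoids? s x) * count k s (t - x)))
      ≡⟨ ∑<-cong q (λ i _ → swap Q (𝟙 (avoids? s (+ i))) (count k s (t - + i))) ⟩
    ∑ᵣ (λ x → 𝟙 (avoids? s x) * (Q * count k s (t - x)))
      ∎
    where
    open ≡-Reasoning
    swap : ∀ a b c → a * (b * c) ≡ b * (a * c)
    swap = solve-∀

  ∑ᵣ-affine : ∀ e c (g : ℤ → ℤ) → ∑ᵣ (λ x → e + c * g x) ≡ Q * e + c * ∑ᵣ g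
  ∑ᵣ-affine e c g = trans (∑<-+ q (λ _ → e) (λ i → c * g (+ i)))
                          (cong₂ _+_ (∑<-const q e) (∑<-*ˡ q c (g ∘ +_)))

  count-closed : ∀ k {s} t → ¬ s ∼ 0ℤ →
    Q * count k s t ≡ (Q - + 2) ^ k - (- + 1) ^ k * (+ 2) ^ k + Q * (- + 1) ^ k * binaryWords k s t
  count-closed zero {s} t _ = trans (cong (Q *_) (𝟙-cong (0ℤ ∼? t) (t ∼? 0ℤ * s) (mk⇔ to from))) (base Q _)
    where
    base : ∀ Q x → Q * x ≡ 1ℤ - 1ℤ * 1ℤ + Q * 1ℤ * (1ℤ * x + 0ℤ)
    base = solve-∀
    to : 0ℤ ∼ t → t ∼ 0ℤ * s
    to 0∼t = ∼-trans (∼-sym 0∼t) (∼-reflexive (sym (ℤP.*-zeroˡ s)))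
    from : t ∼ 0ℤ * s → 0ℤ ∼ t
    from t∼0s = ∼-sym (∼-trans t∼0s (∼-reflexive (ℤP.*-zeroˡ s)))
  count-closed (suc k) {s} t s≁0 = begin
    Q * count (suc k) s t
      ≡⟨ scaled-count-suc k s t ⟩
    ∑ᵣ (λ x → 𝟙 (avoids? s x) * (Q * count k s (t - x)))
      ≡⟨ ∑<-cong q (λ i _ → cong (_*_ (𝟙 (avoids? s (+ i)))) (count-closed k (t - + i) s≁0)) ⟩
    ∑ᵣ (λ x → 𝟙 (avoids? s x) * h x)
      ≡⟨ ∑ᵣ-avoiding h-resp s≁0 ⟩
    ∑ᵣ h - h 0ℤ - h s
      ≡⟨ cong₂ (λ a b → a - b - h s) ∑ᵣh h0 ⟩
    (Q * Eₖ + Q * Mₖ * Pₖ) - (Eₖ + Q * Mₖ * W t) - (Eₖ + Q * Mₖ * W (t - s))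
      ≡⟨ step Q Aₖ Mₖ Pₖ (W t) (W (t - s)) ⟩
    (Q - + 2) * Aₖ - (- + 1) * Mₖ * (+ 2 * Pₖ) + Q * ((- + 1) * Mₖ) * (W t + W (t - s))
      ≡⟨ cong (λ z → (Q - + 2) * Aₖ - (- + 1) * Mₖ * (+ 2 * Pₖ) + Q * ((- + 1) * Mₖ) * z) (binaryWords-suc k s t) ⟨
    (Q - + 2) ^ suc k - (- + 1) ^ suc k * (+ 2) ^ suc k + Q * (- + 1) ^ suc k * binaryWords (suc k) s t
      ∎
    where
    open ≡-Reasoning
    Aₖ Mₖ Pₖ Eₖ : ℤ
    Aₖ = (Q - + 2) ^ k
    Mₖ = (- + 1) ^ k
    Pₖ = (+ 2) ^ k
    Eₖ = Aₖ - Mₖ * Pₖ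
    W : ℤ → ℤ
    W = binaryWords k s
    h : ℤ → ℤ
    h x = Eₖ + Q * Mₖ * W (t - x)
    h-resp : h Preserves _∼_ ⟶ _≡_
    h-resp x∼y = cong (λ z → Eₖ + Q * Mₖ * z) (binaryWords-respʳ k s (∼-+ (∼-refl {t}) (∼-neg x∼y)))
    ∑ᵣh : ∑ᵣ h ≡ Q * Eₖ + Q * Mₖ * Pₖ
    ∑ᵣh = trans (∑ᵣ-affine Eₖ (Q * Mₖ) (λ x → W (t - x)))
                (cong (λ z → Q * Eₖ + Q * Mₖ * z) (∑ᵣ-binaryWords k s t))
    h0 : h 0ℤ ≡ Eₖ + Q * Mₖ * W t
    h0 = cong (λ z → Eₖ + Q * Mₖ * z) (binaryWords-respʳ k s (∼-reflexive (ℤP.+-identityʳ t)))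
    -- shaped like the unfolding x ^ suc k = x * x ^ k of the powers on the right
    step : ∀ Q A M P W₁ W₂ →
      (Q * (A - M * P) + Q * M * P) - (A - M * P + Q * M * W₁) - (A - M * P + Q * M * W₂)
        ≡ (Q - + 2) * A - (- + 1) * M * (+ 2 * P) + Q * ((- + 1) * M) * (W₁ + W₂)
    step = solve-∀

  count-closed₀ : ∀ k {s} t → s ∼ 0ℤ →
    Q * count k s t ≡ (Q - + 1) ^ k - (- + 1) ^ k + Q * (- + 1) ^ k * 𝟙 (t ∼? 0ℤ)
  count-closed₀ zero    t _ = trans (cong (Q *_) (𝟙-cong (0ℤ ∼? t) (t ∼? 0ℤ) (mk⇔ ∼-sym ∼-sym))) (base Q _)
    where
    base : ∀ Q x → Q * x ≡ 1ℤ - 1ℤ + Q * 1ℤ * x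
    base = solve-∀
  count-closed₀ (suc k) {s} t s∼0 = begin
    Q * count (suc k) s t
      ≡⟨ scaled-count-suc k s t ⟩
    ∑ᵣ (λ x → 𝟙 (avoids? s x) * (Q * count k s (t - x)))
      ≡⟨ ∑<-cong q (λ i _ → cong (_*_ (𝟙 (avoids? s (+ i)))) (count-closed₀ k (t - + i) s∼0)) ⟩
    ∑ᵣ (λ x → 𝟙 (avoids? s x) * h x)
      ≡⟨ ∑ᵣ-avoiding₀ h-resp s∼0 ⟩
    ∑ᵣ h - h 0ℤ
      ≡⟨ cong₂ _-_ ∑ᵣh h0 ⟩
    (Q * Fₖ + Q * Mₖ * 1ℤ) - (Fₖ + Q * Mₖ * 𝟙 (t ∼? 0ℤ))
      ≡⟨ step Q Aₖ Mₖ (𝟙 (t ∼? 0ℤ)) ⟩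
    (Q - + 1) ^ suc k - (- + 1) ^ suc k + Q * (- + 1) ^ suc k * 𝟙 (t ∼? 0ℤ)
      ∎
    where
    open ≡-Reasoning
    Aₖ Mₖ Fₖ : ℤ
    Aₖ = (Q - + 1) ^ k
    Mₖ = (- + 1) ^ k
    Fₖ = Aₖ - Mₖ
    h : ℤ → ℤ
    h x = Fₖ + Q * Mₖ * 𝟙 (t - x ∼? 0ℤ)
    h-resp : h Preserves _∼_ ⟶ _≡_
    h-resp {x} {y} x∼y = cong (λ z → Fₖ + Q * Mₖ * z) (𝟙-cong (t - x ∼? 0ℤ) (t - y ∼? 0ℤ) (mk⇔
      (∼-trans (∼-+ (∼-refl {t}) (∼-neg (∼-sym x∼y)))) (∼-trans (∼-+ (∼-refl {t}) (∼-neg x∼y)))))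
    ∑ᵣh : ∑ᵣ h ≡ Q * Fₖ + Q * Mₖ * 1ℤ
    ∑ᵣh = trans (∑ᵣ-affine Fₖ (Q * Mₖ) (λ x → 𝟙 (t - x ∼? 0ℤ)))
                (cong (λ z → Q * Fₖ + Q * Mₖ * z) (∑ᵣ-𝟙-sub t 0ℤ))
    t-0 : ∀ t → t - 0ℤ ≡ (t - 0ℤ) - 0ℤ
    t-0 = solve-∀
    h0 : h 0ℤ ≡ Fₖ + Q * Mₖ * 𝟙 (t ∼? 0ℤ)
    h0 = cong (λ z → Fₖ + Q * Mₖ * z)
              (𝟙-cong (t - 0ℤ ∼? 0ℤ) (t ∼? 0ℤ) (mk⇔ (∼-by-diff (t-0 t)) (∼-by-diff (sym (t-0 t)))))
    step : ∀ Q A M I → (Q * (A - M) + Q * M * 1ℤ) - (A - M + Q * M * I)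
                         ≡ (Q - + 1) * A - (- + 1) * M + Q * ((- + 1) * M) * I
    step = solve-∀

  dot : ∀ {k} → Vec (Fin q) k → (Fin k → ℤ) → ℤ
  dot []      c = 0ℤ
  dot (x ∷ u) c = val x * c Fin.zero + dot u (c ∘ Fin.suc)

  dotCol≡dot : ∀ {k n} (u : Vec (Fin q) k) (G : IntMat k n) j → dotCol u G j ≡ dot u (λ l → G l j)
  dotCol≡dot []      G j = refl
  dotCol≡dot (x ∷ u) G j = cong (_+_ (val x * G Fin.zero j)) (dotCol≡dot u (G ∘ Fin.suc) j)

  dot-cong : ∀ {k} (u : Vec (Fin q) k) {c d : Fin k → ℤ} → (∀ l → c l ≡ d l) → dot u c ≡ dot u d
  dot-cong []      c≡d = refl
  dot-cong (x ∷ u) c≡d = cong₂ _+_ (cong (val x *_) (c≡d Fin.zero)) (dot-cong u (c≡d ∘ Fin.suc))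

  dot-- : ∀ {k} (u : Vec (Fin q) k) (c d : Fin k → ℤ) → dot u (λ l → c l - d l) ≡ dot u c - dot u d
  dot-- []      c d = refl
  dot-- (x ∷ u) c d = trans (cong (_+_ (val x * (c Fin.zero - d Fin.zero))) (dot-- u (c ∘ Fin.suc) (d ∘ Fin.suc)))
                            (distrib (val x) (c Fin.zero) (d Fin.zero) _ _)
    where
    distrib : ∀ x a b A B → x * (a - b) + (A - B) ≡ x * a + A - (x * b + B)
    distrib = solve-∀

  dot-0 : ∀ {k} (u : Vec (Fin q) k) → dot u (λ _ → 0ℤ) ≡ 0ℤ
  dot-0 []      = refl
  dot-0 (x ∷ u) = trans (cong₂ _+_ (ℤP.*-zeroʳ (val x)) (dot-0 u)) refl

  dot-1 : ∀ {k} (u : Vec (Fin q) k) → dot u (λ _ → 1ℤ) ≡ total u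
  dot-1 []      = refl
  dot-1 (x ∷ u) = cong₂ _+_ (ℤP.*-identityʳ (val x)) (dot-1 u)

  dot-𝟙≟ : ∀ {k} (u : Vec (Fin q) k) i → dot u (λ l → 𝟙 (l FinP.≟ i)) ≡ val (lookup u i)
  dot-𝟙≟ (x ∷ u) Fin.zero    = trans (cong₂ _+_ (ℤP.*-identityʳ (val x)) (dot-0 u)) (ℤP.+-identityʳ (val x))
  dot-𝟙≟ (x ∷ u) (Fin.suc i) = trans (cong₂ _+_ (ℤP.*-zeroʳ (val x)) (dot-𝟙≟ u i)) (ℤP.+-identityˡ _)

  dot-δ : ∀ {k} (u : Vec (Fin q) k) i → dot u (λ l → δ l i) ≡ val (lookup u i)
  dot-δ u i = trans (dot-cong u (λ l → δ≡𝟙 l i)) (dot-𝟙≟ u i)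

  Ñ-entry : ∀ {k} → Vec (Fin q) k → Fin k ⊎ Fin k → ℤ
  Ñ-entry u = [ (λ i → val (lookup u i)) , (λ i → total u - val (lookup u i)) ]′

  dotCol-Ñ : ∀ {k} (u : Vec (Fin q) k) j → dotCol u (Ñ k) j ≡ Ñ-entry u (splitAt k j)
  dotCol-Ñ {k} u j =
    trans (dotCol≡dot u (Ñ k) j) (trans (dot-cong u (λ l → Ñ-column k l j)) (by-block (splitAt k j)))
    where
    by-block : ∀ x → dot u (λ l → [ δ l , (λ i → 1ℤ - δ l i) ]′ x) ≡ Ñ-entry u x
    by-block (inj₁ i) = dot-δ u i
    by-block (inj₂ i) = trans (dot-- u (λ _ → 1ℤ) (λ l → δ l i)) (cong₂ _-_ (dot-1 u) (dot-δ u i))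

  dotCol-Z̃ : ∀ {k} (u : Vec (Fin q) k) j →
             dotCol u (Z̃ k) j ≡ [ dotCol u (Ñ k) , (λ _ → total u) ]′ (splitAt (k ℕ.+ k) j)
  dotCol-Z̃ {k} u j =
    trans (dotCol≡dot u (Z̃ k) j) (trans (dot-cong u (λ l → Z̃-column k l j)) (by-block (splitAt (k ℕ.+ k) j)))
    where
    by-block : ∀ x → dot u (λ l → [ Ñ k l , (λ _ → 1ℤ) ]′ x) ≡ [ dotCol u (Ñ k) , (λ _ → total u) ]′ x
    by-block (inj₁ i) = sym (dotCol≡dot u (Ñ k) i)
    by-block (inj₂ _) = dot-1 u

  Nonzero : ℤ → Set
  Nonzero z = ¬ z ∼ 0ℤ

  offAll⇔ : ∀ {k n} (G : IntMat k n) (u : Vec (Fin q) k) → OffAll G q u ⇔ (∀ j → ¬ dotCol u G j ∼ 0ℤ)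
  offAll⇔ G u = mk⇔ (λ off j z∼0 → ListAllP.tabulate⁻ off j (∼0⇒%ℕ≡0 _ z∼0))
                    (λ nz → ListAllP.tabulate⁺ (λ j z%q≡0 → nz j (%ℕ≡0⇒∼0 _ z%q≡0)))

  ∼⇔-∼0 : ∀ {a b} → a ∼ b ⇔ b - a ∼ 0ℤ
  ∼⇔-∼0 {a} {b} = mk⇔ (λ a∼b → ∼-by-diff (flip a b) (∼-sym a∼b))
                      (λ b-a∼0 → ∼-sym (∼-by-diff (sym (flip a b)) b-a∼0))
    where
    flip : ∀ a b → b - a - 0ℤ ≡ b - a
    flip = solve-∀

  Ñ-entries⇔ : ∀ {k} (u : Vec (Fin q) k) → (∀ x → ¬ Ñ-entry u x ∼ 0ℤ) ⇔ Avoiding (total u) u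
  Ñ-entries⇔ u = mk⇔
    (λ nz → VecAllP.lookup⁻ (λ i → nz (inj₁ i) , nz (inj₂ i) ∘ Equivalence.to ∼⇔-∼0))
    (λ avoiding → [_,_] (proj₁ ∘ VecAllP.lookup⁺ avoiding)
                        (λ i → proj₂ (VecAllP.lookup⁺ avoiding i) ∘ Equivalence.from ∼⇔-∼0))

  nonzeroColumns-Ñ⇔ : ∀ {k} (u : Vec (Fin q) k) → (∀ j → ¬ dotCol u (Ñ k) j ∼ 0ℤ) ⇔ Avoiding (total u) u
  nonzeroColumns-Ñ⇔ {k} u = ⇔.trans (∀-blocks⇔ k {P = Nonzero} (dotCol-Ñ u)) (Ñ-entries⇔ u)

  offAll-Ñ⇔ : ∀ {k} (u : Vec (Fin q) k) → OffAll (Ñ k) q u ⇔ Avoiding (total u) u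
  offAll-Ñ⇔ {k} u = ⇔.trans (offAll⇔ (Ñ k) u) (nonzeroColumns-Ñ⇔ u)

  offAll-Z̃⇔ : ∀ {k} (u : Vec (Fin q) k) → OffAll (Z̃ k) q u ⇔ (Avoiding (total u) u × ¬ total u ∼ 0ℤ)
  offAll-Z̃⇔ {k} u =
    ⇔.trans (offAll⇔ (Z̃ k) u)
    (⇔.trans (∀-blocks⇔ (k ℕ.+ k) {P = Nonzero} (dotCol-Z̃ u))
    (⇔.trans (∀-⊎⇔ {P = Nonzero} (dotCol u (Ñ k)) (total u))
             (nonzeroColumns-Ñ⇔ u ×-⇔ ⇔.refl)))

  ∑ᵣ-fixed : ∀ j → ∑ᵣ (λ x → 𝟙 (x ∼? + j * x)) ≡ gcd (+ j - 1ℤ) (+ q)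
  ∑ᵣ-fixed j = trans (∑<-cong q (λ s _ → 𝟙-cong (+ s ∼? + j * + s) (+ q ∣? (+ j - 1ℤ) * + s) (mk⇔
                       (λ s∼js → subst (+ q ℤ∣.∣_) (factor (+ s) (+ j)) (divides-diff (∼-sym s∼js)))
                       (λ q∣[j-1]s → ∼-sym (∣⇒∼ (factor (+ s) (+ j)) q∣[j-1]s)))))
                     (∑<-∣*ℤ (+ j - 1ℤ) q)
    where
    factor : ∀ s j → j * s - s ≡ (j - 1ℤ) * s
    factor = solve-∀

  ∑ᵣ-nonzero-fixed : ∀ j → ∑ᵣ (λ x → 𝟙 (¬? (x ∼? 0ℤ)) * 𝟙 (x ∼? + j * x)) ≡ gcd (+ j - 1ℤ) (+ q) - 1ℤ
  ∑ᵣ-nonzero-fixed j = trans (∑ᵣ-nonzero fixed-resp)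
    (cong₂ _-_ (∑ᵣ-fixed j) (𝟙-yes (0ℤ ∼? + j * 0ℤ) (∼-reflexive (sym (ℤP.*-zeroʳ (+ j))))))
    where
    fixed-resp : (λ x → 𝟙 (x ∼? + j * x)) Preserves _∼_ ⟶ _≡_
    fixed-resp {x} {y} x∼y = 𝟙-cong (x ∼? + j * x) (y ∼? + j * y) (mk⇔
      (λ x∼jx → ∼-trans (∼-sym x∼y) (∼-trans x∼jx (∼-*ˡ (+ j) x∼y)))
      (λ y∼jy → ∼-trans x∼y (∼-trans y∼jy (∼-*ˡ (+ j) (∼-sym x∼y)))))

  ∑ᵣ-nonzero-binaryWords : ∀ k →
    ∑ᵣ (λ s → 𝟙 (¬? (s ∼? 0ℤ)) * binaryWords k s s) ≡ binomGcdSum k q - (+ 2) ^ k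
  ∑ᵣ-nonzero-binaryWords k = begin
    ∑ᵣ (λ s → 𝟙 (¬? (s ∼? 0ℤ)) * binaryWords k s s)
      ≡⟨ ∑<-cong q (λ s _ → trans (sym (∑<-*ˡ (suc k) (𝟙 (¬? (+ s ∼? 0ℤ))) (term (+ s))))
                                  (∑<-cong (suc k) (λ j _ →
                                     swap (𝟙 (¬? (+ s ∼? 0ℤ))) (+ (k C j)) (𝟙 (+ s ∼? + j * + s))))) ⟩
    ∑< q (λ s → ∑< (suc k) (λ j → + (k C j) * (𝟙 (¬? (+ s ∼? 0ℤ)) * 𝟙 (+ s ∼? + j * + s))))
      ≡⟨ ∑<-comm q (suc k) (λ s j → + (k C j) * (𝟙 (¬? (+ s ∼? 0ℤ)) * 𝟙 (+ s ∼? + j * + s))) ⟩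
    ∑< (suc k) (λ j → ∑< q (λ s → + (k C j) * (𝟙 (¬? (+ s ∼? 0ℤ)) * 𝟙 (+ s ∼? + j * + s))))
      ≡⟨ ∑<-cong (suc k) (λ j _ → trans (∑<-*ˡ q (+ (k C j)) (λ s → 𝟙 (¬? (+ s ∼? 0ℤ)) * 𝟙 (+ s ∼? + j * + s)))
                                        (cong (_*_ (+ (k C j))) (∑ᵣ-nonzero-fixed j))) ⟩
    ∑< (suc k) (λ j → + (k C j) * (gcd (+ j - 1ℤ) (+ q) - 1ℤ))
      ≡⟨ ∑<-cong (suc k) (λ j _ → distrib (+ (k C j)) (gcd (+ j - 1ℤ) (+ q))) ⟩
    ∑< (suc k) (λ j → + (k C j) * gcd (+ j - 1ℤ) (+ q) - + (k C j) * 1ℤ)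
      ≡⟨ ∑<-- (suc k) (λ j → + (k C j) * gcd (+ j - 1ℤ) (+ q)) (λ j → + (k C j) * 1ℤ) ⟩
    ∑< (suc k) (λ j → + (k C j) * gcd (+ j - 1ℤ) (+ q)) - ∑< (suc k) (λ j → + (k C j) * 1ℤ)
      ≡⟨ cong₂ _-_ (sym (binomGcdSum≡∑< k q)) (∑-binomial k) ⟩
    binomGcdSum k q - (+ 2) ^ k
      ∎
    where
    open ≡-Reasoning
    term : ℤ → ℕ → ℤ
    term s j = + (k C j) * 𝟙 (s ∼? + j * s)
    swap : ∀ a b c → a * (b * c) ≡ b * (a * c)
    swap = solve-∀
    distrib : ∀ c g → c * (g - 1ℤ) ≡ c * g - c * 1ℤ
    distrib = solve-∀

  χ-Z̃≡ : ∀ k → + χquasi (Z̃ k) q ≡ ∑ᵣ (λ s → 𝟙 (¬? (s ∼? 0ℤ)) * count k s s)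
  χ-Z̃≡ k = begin
    + χquasi (Z̃ k) q
      ≡⟨ length-filter-allVecs q k (offAll? (Z̃ k) q) ⟩
    ∑ⱽ q k (𝟙 ∘ offAll? (Z̃ k) q)
      ≡⟨ ∑ⱽ-cong q k by-total ⟩
    ∑ⱽ q k (λ u → ∑ᵣ (λ s → 𝟙 (¬? (s ∼? 0ℤ)) * 𝟙 (avoiding? s u ×-dec (total u ∼? s))))
      ≡⟨ ∑ⱽ-∑< q k q (λ u s → 𝟙 (¬? (+ s ∼? 0ℤ)) * 𝟙 (avoiding? (+ s) u ×-dec (total u ∼? + s))) ⟩
    ∑ᵣ (λ s → ∑ⱽ q k (λ u → 𝟙 (¬? (s ∼? 0ℤ)) * 𝟙 (avoiding? s u ×-dec (total u ∼? s))))
      ≡⟨ ∑<-cong q (λ s _ → ∑ⱽ-*ˡ q k (𝟙 (¬? (+ s ∼? 0ℤ))) (λ u → 𝟙 (avoiding? (+ s) u ×-dec (total u ∼? + s)))) ⟩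
    ∑ᵣ (λ s → 𝟙 (¬? (s ∼? 0ℤ)) * count k s s)
      ∎
    where
    open ≡-Reasoning
    rearrange : ∀ a b c → a * (b * c) ≡ c * (b * a)
    rearrange = solve-∀
    by-total : ∀ u →
      𝟙 (offAll? (Z̃ k) q u) ≡ ∑ᵣ (λ s → 𝟙 (¬? (s ∼? 0ℤ)) * 𝟙 (avoiding? s u ×-dec (total u ∼? s)))
    by-total u = begin
      𝟙 (offAll? (Z̃ k) q u)
        ≡⟨ 𝟙-cong (offAll? (Z̃ k) q u) (avoiding? (total u) u ×-dec ¬? (total u ∼? 0ℤ)) (offAll-Z̃⇔ u) ⟩
      g (total u)
        ≡⟨ ∑ᵣ-δ (total u) g-resp ⟨
      ∑ᵣ (λ s → 𝟙 (s ∼? total u) * g s)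
        ≡⟨ ∑<-cong q (λ s _ → regroup (+ s)) ⟩
      ∑ᵣ (λ s → 𝟙 (¬? (s ∼? 0ℤ)) * 𝟙 (avoiding? s u ×-dec (total u ∼? s)))
        ∎
      where
      g : ℤ → ℤ
      g s = 𝟙 (avoiding? s u ×-dec ¬? (s ∼? 0ℤ))
      g-resp : g Preserves _∼_ ⟶ _≡_
      g-resp {s} {s′} s∼s′ = 𝟙-cong (avoiding? s u ×-dec ¬? (s ∼? 0ℤ)) (avoiding? s′ u ×-dec ¬? (s′ ∼? 0ℤ)) (mk⇔
        (λ (av , s≁0) → Avoiding-resp s∼s′ av , s≁0 ∘ ∼-trans s∼s′)
        (λ (av , s′≁0) → Avoiding-resp (∼-sym s∼s′) av , s′≁0 ∘ ∼-trans (∼-sym s∼s′)))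
      regroup : ∀ s → 𝟙 (s ∼? total u) * g s ≡ 𝟙 (¬? (s ∼? 0ℤ)) * 𝟙 (avoiding? s u ×-dec (total u ∼? s))
      regroup s = begin
        𝟙 (s ∼? total u) * g s
          ≡⟨ cong (𝟙 (s ∼? total u) *_) (𝟙-× (avoiding? s u) (¬? (s ∼? 0ℤ))) ⟩
        𝟙 (s ∼? total u) * (𝟙 (avoiding? s u) * 𝟙 (¬? (s ∼? 0ℤ)))
          ≡⟨ rearrange (𝟙 (s ∼? total u)) (𝟙 (avoiding? s u)) (𝟙 (¬? (s ∼? 0ℤ))) ⟩
        𝟙 (¬? (s ∼? 0ℤ)) * (𝟙 (avoiding? s u) * 𝟙 (s ∼? total u))
          ≡⟨ cong (λ z → 𝟙 (¬? (s ∼? 0ℤ)) * (𝟙 (avoiding? s u) * z))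
                  (𝟙-cong (s ∼? total u) (total u ∼? s) (mk⇔ ∼-sym ∼-sym)) ⟩
        𝟙 (¬? (s ∼? 0ℤ)) * (𝟙 (avoiding? s u) * 𝟙 (total u ∼? s))
          ≡⟨ cong (𝟙 (¬? (s ∼? 0ℤ)) *_) (𝟙-× (avoiding? s u) (total u ∼? s)) ⟨
        𝟙 (¬? (s ∼? 0ℤ)) * 𝟙 (avoiding? s u ×-dec (total u ∼? s))
          ∎

  χ-Ñ≡ : ∀ k → + χquasi (Ñ k) q ≡ + χquasi (Z̃ k) q + count k 0ℤ 0ℤ
  χ-Ñ≡ k = begin
    + χquasi (Ñ k) q
      ≡⟨ length-filter-allVecs q k (offAll? (Ñ k) q) ⟩
    ∑ⱽ q k (𝟙 ∘ offAll? (Ñ k) q)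
      ≡⟨ ∑ⱽ-cong q k split ⟩
    ∑ⱽ q k (λ u → 𝟙 (offAll? (Z̃ k) q u) + 𝟙 (avoiding? 0ℤ u ×-dec (total u ∼? 0ℤ)))
      ≡⟨ ∑ⱽ-+ q k (𝟙 ∘ offAll? (Z̃ k) q) (λ u → 𝟙 (avoiding? 0ℤ u ×-dec (total u ∼? 0ℤ))) ⟩
    ∑ⱽ q k (𝟙 ∘ offAll? (Z̃ k) q) + count k 0ℤ 0ℤ
      ≡⟨ cong (_+ count k 0ℤ 0ℤ) (length-filter-allVecs q k (offAll? (Z̃ k) q)) ⟨
    + χquasi (Z̃ k) q + count k 0ℤ 0ℤ
      ∎
    where
    open ≡-Reasoning
    split : ∀ u → 𝟙 (offAll? (Ñ k) q u) ≡ 𝟙 (offAll? (Z̃ k) q u) + 𝟙 (avoiding? 0ℤ u ×-dec (total u ∼? 0ℤ))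
    split u = begin
      𝟙 (offAll? (Ñ k) q u)
        ≡⟨ 𝟙-cong (offAll? (Ñ k) q u) (avoiding? S u) (offAll-Ñ⇔ u) ⟩
      𝟙 (avoiding? S u)
        ≡⟨ 𝟙-split (S ∼? 0ℤ) (avoiding? S u) ⟩
      𝟙 (¬? (S ∼? 0ℤ) ×-dec avoiding? S u) + 𝟙 ((S ∼? 0ℤ) ×-dec avoiding? S u)
        ≡⟨ cong₂ _+_
             (𝟙-cong (¬? (S ∼? 0ℤ) ×-dec avoiding? S u) (offAll? (Z̃ k) q u)
                     (⇔.trans (mk⇔ Product.swap Product.swap) (⇔.sym (offAll-Z̃⇔ u))))
             (𝟙-cong ((S ∼? 0ℤ) ×-dec avoiding? S u) (avoiding? 0ℤ u ×-dec (S ∼? 0ℤ)) (mk⇔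
               (λ (S∼0 , av) → Avoiding-resp S∼0 av , S∼0)
               (λ (av , S∼0) → S∼0 , Avoiding-resp (∼-sym S∼0) av))) ⟩
      𝟙 (offAll? (Z̃ k) q u) + 𝟙 (avoiding? 0ℤ u ×-dec (S ∼? 0ℤ))
        ∎
      where S = total u

  Z̃-numerator Ñ-numerator : ℕ → ℤ
  Z̃-numerator k = (Q - 1ℤ) * (Q - + 2) ^ k - (- + 2) ^ k * (+ 2 * Q - 1ℤ)
  Ñ-numerator k = (Q - 1ℤ) ^ k + (- + 1) ^ k * (Q - 1ℤ)

  scaled-χ-Z̃ : ∀ k → Q * + χquasi (Z̃ k) q ≡ Z̃-numerator k + Q * ((- + 1) ^ k * binomGcdSum k q)
  scaled-χ-Z̃ k = begin
    Q * + χquasi (Z̃ k) q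
      ≡⟨ cong (Q *_) (χ-Z̃≡ k) ⟩
    Q * ∑ᵣ (λ s → 𝟙 (¬? (s ∼? 0ℤ)) * count k s s)
      ≡⟨ ∑<-*ˡ q Q (λ s → 𝟙 (¬? (+ s ∼? 0ℤ)) * count k (+ s) (+ s)) ⟨
    ∑ᵣ (λ s → Q * (𝟙 (¬? (s ∼? 0ℤ)) * count k s s))
      ≡⟨ ∑<-cong q (λ s _ → trans (swap Q (𝟙 (¬? (+ s ∼? 0ℤ))) (count k (+ s) (+ s)))
                                  (𝟙*-cong (¬? (+ s ∼? 0ℤ)) (count-closed k (+ s)))) ⟩
    ∑ᵣ (λ s → 𝟙 (¬? (s ∼? 0ℤ)) * (Eₖ + Q * Mₖ * binaryWords k s s))
      ≡⟨ ∑<-cong q (λ s _ → distrib (𝟙 (¬? (+ s ∼? 0ℤ))) Eₖ (Q * Mₖ) (binaryWords k (+ s) (+ s))) ⟩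
    ∑ᵣ (λ s → Eₖ * (𝟙 (¬? (s ∼? 0ℤ)) * 1ℤ) + Q * Mₖ * (𝟙 (¬? (s ∼? 0ℤ)) * binaryWords k s s))
      ≡⟨ ∑<-+ q (λ s → Eₖ * (𝟙 (¬? (+ s ∼? 0ℤ)) * 1ℤ))
                (λ s → Q * Mₖ * (𝟙 (¬? (+ s ∼? 0ℤ)) * binaryWords k (+ s) (+ s))) ⟩
    ∑ᵣ (λ s → Eₖ * (𝟙 (¬? (s ∼? 0ℤ)) * 1ℤ))
      + ∑ᵣ (λ s → Q * Mₖ * (𝟙 (¬? (s ∼? 0ℤ)) * binaryWords k s s))
      ≡⟨ cong₂ _+_ (trans (∑<-*ˡ q Eₖ (λ s → 𝟙 (¬? (+ s ∼? 0ℤ)) * 1ℤ)) (cong (Eₖ *_) nonzero-residues))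
                   (trans (∑<-*ˡ q (Q * Mₖ) (λ s → 𝟙 (¬? (+ s ∼? 0ℤ)) * binaryWords k (+ s) (+ s)))
                          (cong (Q * Mₖ *_) (∑ᵣ-nonzero-binaryWords k))) ⟩
    Eₖ * (Q - 1ℤ) + Q * Mₖ * (binomGcdSum k q - Pₖ)
      ≡⟨ finish Q ((Q - + 2) ^ k) Mₖ Pₖ (binomGcdSum k q) ⟩
    (Q - 1ℤ) * (Q - + 2) ^ k - Mₖ * Pₖ * (+ 2 * Q - 1ℤ) + Q * (Mₖ * binomGcdSum k q)
      ≡⟨ cong (λ z → (Q - 1ℤ) * (Q - + 2) ^ k - z * (+ 2 * Q - 1ℤ) + Q * (Mₖ * binomGcdSum k q)) (^-neg (+ 2) k) ⟨
    (Q - 1ℤ) * (Q - + 2) ^ k - (- + 2) ^ k * (+ 2 * Q - 1ℤ) + Q * (Mₖ * binomGcdSum k q)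
      ∎
    where
    open ≡-Reasoning
    Mₖ Pₖ Eₖ : ℤ
    Mₖ = (- + 1) ^ k
    Pₖ = (+ 2) ^ k
    Eₖ = (Q - + 2) ^ k - Mₖ * Pₖ
    nonzero-residues : ∑ᵣ (λ s → 𝟙 (¬? (s ∼? 0ℤ)) * 1ℤ) ≡ Q - 1ℤ
    nonzero-residues = trans (∑ᵣ-nonzero {λ _ → 1ℤ} (λ _ → refl))
                             (cong (_- 1ℤ) (trans (∑<-const q 1ℤ) (ℤP.*-identityʳ Q)))
    swap : ∀ a b c → a * (b * c) ≡ b * (a * c)
    swap = solve-∀
    distrib : ∀ i e c w → i * (e + c * w) ≡ e * (i * 1ℤ) + c * (i * w)
    distrib = solve-∀
    finish : ∀ Q A M P G → (A - M * P) * (Q - 1ℤ) + Q * M * (G - P)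
                             ≡ (Q - 1ℤ) * A - M * P * (+ 2 * Q - 1ℤ) + Q * (M * G)
    finish = solve-∀

  scaled-χ-Ñ : ∀ k → Q * + χquasi (Ñ k) q ≡ Ñ-numerator k + Q * + χquasi (Z̃ k) q
  scaled-χ-Ñ k = begin
    Q * + χquasi (Ñ k) q
      ≡⟨ cong (Q *_) (χ-Ñ≡ k) ⟩
    Q * (+ χquasi (Z̃ k) q + count k 0ℤ 0ℤ)
      ≡⟨ ℤP.*-distribˡ-+ Q (+ χquasi (Z̃ k) q) (count k 0ℤ 0ℤ) ⟩
    Q * + χquasi (Z̃ k) q + Q * count k 0ℤ 0ℤ
      ≡⟨ cong (_+_ (Q * + χquasi (Z̃ k) q)) (count-closed₀ k 0ℤ ∼-refl) ⟩
    Q * + χquasi (Z̃ k) q + ((Q - + 1) ^ k - (- + 1) ^ k + Q * (- + 1) ^ k * 𝟙 (0ℤ ∼? 0ℤ))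
      ≡⟨ cong (λ z → Q * + χquasi (Z̃ k) q + ((Q - + 1) ^ k - (- + 1) ^ k + Q * (- + 1) ^ k * z))
              (𝟙-yes (0ℤ ∼? 0ℤ) ∼-refl) ⟩
    Q * + χquasi (Z̃ k) q + ((Q - + 1) ^ k - (- + 1) ^ k + Q * (- + 1) ^ k * 1ℤ)
      ≡⟨ finish Q (+ χquasi (Z̃ k) q) ((Q - + 1) ^ k) ((- + 1) ^ k) ⟩
    (Q - 1ℤ) ^ k + (- + 1) ^ k * (Q - 1ℤ) + Q * + χquasi (Z̃ k) q
      ∎
    where
    open ≡-Reasoning
    finish : ∀ Q X A M → Q * X + ((A - M) + Q * M * 1ℤ) ≡ (A + M * (Q - 1ℤ)) + Q * X
    finish = solve-∀

theorem5p3 : (k q : ℕ) → 1 ≤ k → .{{_ : NonZero q}} →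
    ((+ χquasi (Z̃ k) q) / 1
       ≡ ((((+ q ℤ.- + 1) ℤ.* ((+ q ℤ.- + 2) ℤ.^ k)) ℤ.- ((ℤ.- + 2) ℤ.^ k) ℤ.* ((+ 2 ℤ.* + q) ℤ.- + 1)) / q)
         ℚ.+ ((((ℤ.- + 1) ℤ.^ k) ℤ.* binomGcdSum k q) / 1))
    × ((+ χquasi (Ñ k) q) / 1
       ≡ ((((+ q ℤ.- + 1) ℤ.^ k) ℤ.+ ((ℤ.- + 1) ℤ.^ k) ℤ.* (+ q ℤ.- + 1)) / q)
         ℚ.+ ((+ χquasi (Z̃ k) q) / 1))
theorem5p3 k q _ =
    q*x≡n+q*b⇒x≡n/q+b _ (Z̃-numerator k) _ q (scaled-χ-Z̃ k)
  , q*x≡n+q*b⇒x≡n/q+b _ (Ñ-numerator k) _ q (scaled-χ-Ñ k)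
  where open Modulo q
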